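{- For every word $w\in\{a,b\}^\star$, $m(a\,w\,b)=m(a\,\overline{w}\,b)$.
   Context: For a word $w$, $\overline{w}$ denotes its reversal. Let $A=\begin{pmatrix}1&1\\1&2\end{pmatrix}$, $B=\begin{pmatrix}2&1\\1&1\end{pmatrix}$, and for $w=x_1\cdots x_k\in\{a,b\}^\star$ let $M^w=M^{x_1}\cdots M^{x_k}$ with $M^a=A$, $M^b=B$ ($M^w=I$ for the empty word). The $m$-value is $m(w)=\begin{pmatrix}1&0\end{pmatrix}M^w\begin{pmatrix}0\\1\end{pmatrix}$. -}

module Defs where

open import Data.Nat using (ℕ; _+_; _*_)
open import Data.List using (List; []; _∷_; reverse; _++_)

data Letter : Set where
  a b : Letter

record Mat2 : Set where
  constructor mat
  field
    m11 m12 m21 m22 : ℕ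
open Mat2 public

I₂ : Mat2
I₂ = mat 1 0 0 1

_·_ : Mat2 → Mat2 → Mat2
mat p q r s · mat p' q' r' s' =
  mat (p * p' + q * r') (p * q' + q * s') (r * p' + s * r') (r * q' + s * s')

A : Mat2
A = mat 1 1 1 2

B : Mat2
B = mat 2 1 1 1

M : Letter → Mat2
M a = A
M b = B

Mw : List Letter → Mat2
Mw [] = I₂
Mw (x ∷ w) = M x · Mw w

-- m(w) = (1 0) M^w (0 1)^T  = the (1,2) entry of M^w
mval : List Letter → ℕ
mval w = m12 (Mw w)

-- Each generator is symmetric and transposition reverses products, so
-- M^(reverse w) is the transpose of M^w.  Moreover, since the first row of A
-- and the last column of B are all ones, m(a w b) = (1 1) M^w (1 1)ᵀ is the sum
-- of all entries of M^w, which transposition does not change.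
module Submission where

open import Defs
open import Data.Nat using (ℕ; _+_; _*_)
open import Data.List using (List; []; _∷_; reverse; _++_)
open import Data.List.Properties using (reverse-++)
open import Data.Nat.Tactic.RingSolver using (solve-∀)
open import Relation.Binary.PropositionalEquality
  using (_≡_; refl; cong; cong₂; sym; module ≡-Reasoning)

mat-cong : ∀ {p q r s p' q' r' s' : ℕ} →
  p ≡ p' → q ≡ q' → r ≡ r' → s ≡ s' → mat p q r s ≡ mat p' q' r' s'
mat-cong refl refl refl refl = refl

·-identityˡ : ∀ X → I₂ · X ≡ X
·-identityˡ (mat p q r s) = mat-cong (left p r) (left q s) (right p r) (right q s)
  where
  left : ∀ x y → 1 * x + 0 * y ≡ x
  left = solve-∀
  right : ∀ x y → 0 * x + 1 * y ≡ y
  right = solve-∀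

·-identityʳ : ∀ X → X · I₂ ≡ X
·-identityʳ (mat p q r s) = mat-cong (left p q) (right p q) (left r s) (right r s)
  where
  left : ∀ x y → x * 1 + y * 0 ≡ x
  left = solve-∀
  right : ∀ x y → x * 0 + y * 1 ≡ y
  right = solve-∀

·-assoc : ∀ X Y Z → (X · Y) · Z ≡ X · (Y · Z)
·-assoc (mat p q r s) (mat p' q' r' s') (mat p'' q'' r'' s'') =
  mat-cong (row-col p q p' r' q' s' p'' r'') (row-col p q p' r' q' s' q'' s'')
           (row-col r s p' r' q' s' p'' r'') (row-col r s p' r' q' s' q'' s'')
  where
  row-col : ∀ x y p' r' q' s' p'' r'' →
    (x * p' + y * r') * p'' + (x * q' + y * s') * r''
      ≡ x * (p' * p'' + q' * r'') + y * (r' * p'' + s' * r'')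
  row-col = solve-∀

transpose : Mat2 → Mat2
transpose (mat p q r s) = mat p r q s

transpose-· : ∀ X Y → transpose (X · Y) ≡ transpose Y · transpose X
transpose-· (mat p q r s) (mat p' q' r' s') =
  mat-cong (swap p q p' r') (swap r s p' r') (swap p q q' s') (swap r s q' s')
  where
  swap : ∀ x y x' y' → x * x' + y * y' ≡ x' * x + y' * y
  swap = solve-∀

transpose-M : ∀ x → transpose (M x) ≡ M x
transpose-M a = refl
transpose-M b = refl

Mw-++ : ∀ u v → Mw (u ++ v) ≡ Mw u · Mw v
Mw-++ []      v = sym (·-identityˡ (Mw v))
Mw-++ (x ∷ u) v = begin
  M x · Mw (u ++ v)    ≡⟨ cong (M x ·_) (Mw-++ u v) ⟩
  M x · (Mw u · Mw v)  ≡⟨ sym (·-assoc (M x) (Mw u) (Mw v)) ⟩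
  (M x · Mw u) · Mw v  ∎
  where open ≡-Reasoning

Mw-[_] : ∀ x → Mw (x ∷ []) ≡ M x
Mw-[ x ] = ·-identityʳ (M x)

Mw-reverse : ∀ w → Mw (reverse w) ≡ transpose (Mw w)
Mw-reverse []      = refl
Mw-reverse (x ∷ w) = begin
  Mw (reverse (x ∷ w))               ≡⟨ cong Mw (reverse-++ (x ∷ []) w) ⟩
  Mw (reverse w ++ x ∷ [])           ≡⟨ Mw-++ (reverse w) (x ∷ []) ⟩
  Mw (reverse w) · Mw (x ∷ [])       ≡⟨ cong₂ _·_ (Mw-reverse w) Mw-[ x ] ⟩
  transpose (Mw w) · M x             ≡⟨ cong (transpose (Mw w) ·_) (sym (transpose-M x)) ⟩
  transpose (Mw w) · transpose (M x) ≡⟨ sym (transpose-· (M x) (Mw w)) ⟩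
  transpose (M x · Mw w)             ∎
  where open ≡-Reasoning

entrySum : Mat2 → ℕ
entrySum (mat p q r s) = p + q + r + s

entrySum-transpose : ∀ X → entrySum (transpose X) ≡ entrySum X
entrySum-transpose (mat p q r s) = middle p q r s
  where
  middle : ∀ x y z t → x + z + y + t ≡ x + y + z + t
  middle = solve-∀

m12-A·-·B : ∀ X → m12 (A · (X · B)) ≡ entrySum X
m12-A·-·B (mat p q r s) = sum p q r s
  where
  sum : ∀ x y z t → 1 * (x * 1 + y * 1) + 1 * (z * 1 + t * 1) ≡ x + y + z + t
  sum = solve-∀

mval-a-w-b : ∀ w → mval (a ∷ w ++ b ∷ []) ≡ entrySum (Mw w)
mval-a-w-b w = begin
  m12 (A · Mw (w ++ b ∷ []))     ≡⟨ cong (λ X → m12 (A · X)) (Mw-++ w (b ∷ [])) ⟩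
  m12 (A · (Mw w · Mw (b ∷ []))) ≡⟨ cong (λ X → m12 (A · (Mw w · X))) Mw-[ b ] ⟩
  m12 (A · (Mw w · B))           ≡⟨ m12-A·-·B (Mw w) ⟩
  entrySum (Mw w)                ∎
  where open ≡-Reasoning

lemma2p11 : (w : List Letter) →
    mval (a ∷ w ++ b ∷ []) ≡ mval (a ∷ reverse w ++ b ∷ [])
lemma2p11 w = begin
  mval (a ∷ w ++ b ∷ [])            ≡⟨ mval-a-w-b w ⟩
  entrySum (Mw w)                   ≡⟨ sym (entrySum-transpose (Mw w)) ⟩
  entrySum (transpose (Mw w))       ≡⟨ cong entrySum (sym (Mw-reverse w)) ⟩
  entrySum (Mw (reverse w))         ≡⟨ sym (mval-a-w-b (reverse w)) ⟩
  mval (a ∷ reverse w ++ b ∷ [])    ∎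
  where open ≡-Reasoning
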